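{- Let $f$ be a prime and $\chi$ a Dirichlet character modulo $f$ of order $3$. Let $h\in\mathbb{N}$, let $u$ be a product of pairwise distinct primes each less than $h$, and let $v=v_1\cdots v_\ell$ be a product of pairwise distinct primes with $h\leq v_i<f$. Let $H\in(0,f)$ be real and $X=H/h$. Suppose $3\ell\leq h$. Let $q,t$ be coprime integers with $0\leq t<q\leq X$. Fix a cube root of unity $\omega$ and assume $\chi(N)\neq\omega$ for all integers $N\in[1,H]$ with $(N,uv)=1$. If $u\mid q$, then for every integer $z\in\mathcal{I}(q,t)\sqcup\mathcal{J}(q,t)$, \[ \left|\sum_{n=0}^{h-1}\chi(z+n)\right|\geq\frac{h-3\ell}{2}. \]
   Context: The real intervals are \[ \mathcal{I}(q,t)=\left(\frac{tf}{q},\ \frac{tf+H}{q}-h+1\right],\qquad \mathcal{J}(q,t)=\left[\frac{tf-H}{q},\ \frac{tf}{q}-h+1\right). \]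
   Formalization: The parameter H is a rational number in (0, f) rather than a real one. -}

module Defs where

open import Data.Nat as ℕ using (ℕ; NonZero)
open import Data.Nat.Coprimality using (Coprime)
open import Data.Integer as ℤ using (ℤ; +_)
open import Data.Rational as ℚ using (ℚ)
open import Data.Product using (Σ; _×_)
open import Relation.Binary.PropositionalEquality using (_≡_; _≢_)
open import Relation.Nullary using (¬_)

-- Eisenstein integers ℤ[ω], ω a fixed primitive cube root of unity in ℂ
-- (ω² = -1 - ω).  The element  re + im·ω .  All values of a Dirichlet
-- character of order 3 lie in {0, 1, ω, ω²} ⊂ ℤ[ω] ⊂ ℂ.
record E : Set where
  constructor mkE
  field
    re : ℤ
    im : ℤ
open E public

0E 1E : E
0E = mkE (+ 0) (+ 0)
1E = mkE (+ 1) (+ 0)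

_+E_ : E → E → E
mkE a b +E mkE c d = mkE (a ℤ.+ c) (b ℤ.+ d)

-- (a + bω)(c + dω) = (ac - bd) + (ad + bc - bd)ω
_*E_ : E → E → E
mkE a b *E mkE c d = mkE (a ℤ.* c ℤ.- b ℤ.* d) (a ℤ.* d ℤ.+ b ℤ.* c ℤ.- b ℤ.* d)

-- Norm = squared complex absolute value: |a + bω|² = a² - ab + b².
normE : E → ℤ
normE (mkE a b) = a ℤ.* a ℤ.- a ℤ.* b ℤ.+ b ℤ.* b

cube : E → E
cube x = x *E (x *E x)

record IsDirichletCharE (f : ℕ) (χ : ℤ → E) : Set where
  field
    periodic       : ∀ n → χ (n ℤ.+ + f) ≡ χ n
    multiplicative : ∀ m n → χ (m ℤ.* n) ≡ χ m *E χ n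
    one            : χ (+ 1) ≡ 1E
    zero-nc        : ∀ n → ¬ Coprime ℤ.∣ n ∣ f → χ n ≡ 0E
    nonzero-c      : ∀ n → Coprime ℤ.∣ n ∣ f → χ n ≢ 0E

record IsCubicChar (f : ℕ) (χ : ℤ → E) : Set where
  field
    isChar     : IsDirichletCharE f χ
    cube-triv  : ∀ n → Coprime ℤ.∣ n ∣ f → cube (χ n) ≡ 1E
    nontrivial : Σ ℤ (λ n → Coprime ℤ.∣ n ∣ f × χ n ≢ 1E)

charSum : (ℤ → E) → ℤ → ℕ → E
charSum χ z ℕ.zero = 0E
charSum χ z (ℕ.suc h) = charSum χ z h +E χ (z ℤ.+ + h)

ℤtoℚ : ℤ → ℚ
ℤtoℚ z = z ℚ./ 1

ℕtoℚ : ℕ → ℚ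
ℕtoℚ n = (+ n) ℚ./ 1

_÷ℕ_ : ℚ → (q : ℕ) → .{{NonZero q}} → ℚ
x ÷ℕ q = x ℚ.* ((+ 1) ℚ./ q)

inI : (f h q t : ℕ) .{{_ : NonZero q}} → ℚ → ℤ → Set
inI f h q t H z =
  (ℕtoℚ (t ℕ.* f) ÷ℕ q) ℚ.< ℤtoℚ z
  × ℤtoℚ z ℚ.≤ ((ℕtoℚ (t ℕ.* f) ℚ.+ H) ÷ℕ q) ℚ.- ℕtoℚ h ℚ.+ ℕtoℚ 1

inJ : (f h q t : ℕ) .{{_ : NonZero q}} → ℚ → ℤ → Set
inJ f h q t H z =
  ((ℕtoℚ (t ℕ.* f) ℚ.- H) ÷ℕ q) ℚ.≤ ℤtoℚ z
  × ℤtoℚ z ℚ.< (ℕtoℚ (t ℕ.* f) ÷ℕ q) ℚ.- ℕtoℚ h ℚ.+ ℕtoℚ 1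

{-# OPTIONS --safe #-}
-- For z in 𝓘 (resp. 𝓙) put N n = q (z + n) - tf (resp. tf - q (z + n)) for n < h. These are
-- integers in [1, H] with χ(N n) = χ(±q) χ(z + n); as 0 < N n < f, each χ(z + n) is a cube
-- root of unity. Let w′ = w χ(±q)⁻¹. If χ(z + n) = w′ then χ(N n) = w, so N n has a prime
-- factor in uv. A prime of u divides q, which is coprime to tf, so it divides no N n; a prime
-- r ≥ h of v divides at most one N n, because N a - N b = ±q (a - b). So w′ occurs K ≤ ℓ times
-- among the summands of S = Σ χ(z + n), whence 2 Re (S w̄′) = 3K - h ≤ 3ℓ - h ≤ 0 and
-- 4 |S|² ≥ (2 Re (S w̄′))² ≥ (h - 3ℓ)².
module Submission where

open import Defs
open import Data.Nat as ℕ using (ℕ; NonZero; _<_; _≤_; zero; suc; z≤n; s≤s; _∸_)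
open import Data.Nat.Primality using (Prime; euclidsLemma; prime⇒irreducible; ¬prime[1])
open import Data.Nat.Coprimality using (Coprime; coprime?; coprime-divisor; prime⇒coprime)
open import Data.Nat.Divisibility using (_∣_; _∣?_; divides; ∣-trans; ∣1⇒≡1; >⇒∤; n∣m*n)
open import Data.Integer as ℤ using (ℤ; +_; -[1+_]; ∣_∣; _⊖_)
open import Data.Rational as ℚ using (ℚ; toℚᵘ)
open import Data.List using (List; []; _∷_; length)
open import Data.Nat.ListAction using (product)
open import Data.List.Relation.Unary.All using (All; []; _∷_)
open import Data.List.Relation.Unary.Unique.Propositional using (Unique)
open import Data.Product using (Σ; _×_; _,_; proj₁; proj₂)
open import Data.Sum using (_⊎_; inj₁; inj₂; [_,_])
open import Relation.Binary.PropositionalEquality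
  using (_≡_; _≢_; refl; sym; trans; cong; cong₂; subst; subst₂; module ≡-Reasoning)

import Data.Nat.Properties as ℕP
import Data.Nat.Coprimality as Coprimality
import Data.Nat.Tactic.RingSolver as ℕ-Solver
open import Data.Nat.ListAction.Properties using (∈⇒∣product)
import Data.Integer.Properties as ℤP
import Data.Integer.Divisibility.Signed as ℤ∣
open import Data.Integer.Tactic.RingSolver using (solve-∀)
import Data.Rational.Properties as ℚP
open import Data.Rational.Solver using (module +-*-Solver)
open import Data.Rational.Unnormalised as ℚᵘ using (mkℚᵘ; *≡*; *≤*; *<*)
import Data.Rational.Unnormalised.Properties as ℚᵘP
import Data.List.Relation.Unary.All as All
open import Data.List.Relation.Unary.Any using (Any; here; there)
open import Data.List.Relation.Unary.Any.Properties using (¬Any[])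
open import Data.Bool using (if_then_else_)
open import Data.Empty using (⊥-elim)
open import Function using (_∘_)
open import Relation.Nullary using (Dec; yes; no; does; ¬_; contradiction)
open import Relation.Nullary.Decidable using (map′; _×-dec_)
open import Relation.Unary using (Pred; Decidable; _∩_; ∁)
open import Relation.Unary.Properties using (_∩?_; ∁?)

-- Eisenstein integers and cube roots of unity

ωE ω²E : E
ωE  = mkE (+ 0) (+ 1)
ω²E = mkE -[1+ 0 ] -[1+ 0 ]

data CubeRootOfUnity : E → Set where
  1-root  : CubeRootOfUnity 1E
  ω-root  : CubeRootOfUnity ωE
  ω²-root : CubeRootOfUnity ω²E

_≟E_ : (x y : E) → Dec (x ≡ y)
mkE a b ≟E mkE c d =
  map′ (λ (a≡c , b≡d) → cong₂ mkE a≡c b≡d) (λ { refl → refl , refl }) (a ℤ.≟ c ×-dec b ℤ.≟ d)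

normE-* : ∀ x y → normE (x *E y) ≡ normE x ℤ.* normE y
normE-* (mkE a b) (mkE c d) = identity a b c d
  where
  identity : ∀ a b c d →
    let u = a ℤ.* c ℤ.- b ℤ.* d ; v = a ℤ.* d ℤ.+ b ℤ.* c ℤ.- b ℤ.* d in
    u ℤ.* u ℤ.- u ℤ.* v ℤ.+ v ℤ.* v ≡ (a ℤ.* a ℤ.- a ℤ.* b ℤ.+ b ℤ.* b) ℤ.* (c ℤ.* c ℤ.- c ℤ.* d ℤ.+ d ℤ.* d)
  identity = solve-∀

square≡+∣∣² : ∀ i → i ℤ.* i ≡ + (∣ i ∣ ℕ.* ∣ i ∣)
square≡+∣∣² (+ n)    = ℤP.+◃n≡+n (n ℕ.* n)
square≡+∣∣² -[1+ n ] = ℤP.+◃n≡+n _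

cube≡1⇒≡1 : ∀ i → i ℤ.* (i ℤ.* i) ≡ + 1 → i ≡ + 1
cube≡1⇒≡1 (+ 1)             _ = refl
cube≡1⇒≡1 (+ 0)             ()
cube≡1⇒≡1 (+ suc (suc n))   ()
cube≡1⇒≡1 -[1+ n ]          ()

four*normE : ∀ a b → + 4 ℤ.* normE (mkE a b) ≡ (+ 2 ℤ.* a ℤ.- b) ℤ.* (+ 2 ℤ.* a ℤ.- b) ℤ.+ + 3 ℤ.* (b ℤ.* b)
four*normE = identity
  where
  identity : ∀ a b → + 4 ℤ.* (a ℤ.* a ℤ.- a ℤ.* b ℤ.+ b ℤ.* b) ≡
                     (+ 2 ℤ.* a ℤ.- b) ℤ.* (+ 2 ℤ.* a ℤ.- b) ℤ.+ + 3 ℤ.* (b ℤ.* b)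
  identity = solve-∀

normE-swap : ∀ a b → normE (mkE a b) ≡ normE (mkE b a)
normE-swap = identity
  where
  identity : ∀ a b → a ℤ.* a ℤ.- a ℤ.* b ℤ.+ b ℤ.* b ≡ b ℤ.* b ℤ.- b ℤ.* a ℤ.+ a ℤ.* a
  identity = solve-∀

3*n²≤4⇒n≤1 : ∀ n → 3 ℕ.* (n ℕ.* n) ≤ 4 → n ≤ 1
3*n²≤4⇒n≤1 0             _  = z≤n
3*n²≤4⇒n≤1 1             _  = ℕP.≤-refl
3*n²≤4⇒n≤1 (suc (suc n)) le = contradiction (ℕP.≤-trans 12≤3*[2+n]² le) (ℕP.<⇒≱ (ℕP.m≤m+n 5 7))
  where
  2≤2+n : 2 ≤ suc (suc n)
  2≤2+n = s≤s (s≤s z≤n)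
  12≤3*[2+n]² : 12 ≤ 3 ℕ.* (suc (suc n) ℕ.* suc (suc n))
  12≤3*[2+n]² = ℕP.*-monoʳ-≤ 3 (ℕP.*-mono-≤ 2≤2+n 2≤2+n)

normE≡1⇒∣im∣≤1 : ∀ a b → normE (mkE a b) ≡ + 1 → ∣ b ∣ ≤ 1
normE≡1⇒∣im∣≤1 a b N≡1 = 3*n²≤4⇒n≤1 ∣ b ∣ (ℕP.≤-trans (ℕP.m≤n+m _ ∣ u ∣²) (ℕP.≤-reflexive (sym 4≡)))
  where
  u : ℤ
  u = + 2 ℤ.* a ℤ.- b
  ∣_∣² : ℤ → ℕ
  ∣ i ∣² = ∣ i ∣ ℕ.* ∣ i ∣
  4≡ : 4 ≡ ∣ u ∣² ℕ.+ 3 ℕ.* ∣ b ∣²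
  4≡ = ℤP.+-injective (begin
    + 4                                  ≡⟨ cong (+ 4 ℤ.*_) N≡1 ⟨
    + 4 ℤ.* normE (mkE a b)              ≡⟨ four*normE a b ⟩
    u ℤ.* u ℤ.+ + 3 ℤ.* (b ℤ.* b)        ≡⟨ cong₂ (λ x y → x ℤ.+ + 3 ℤ.* y) (square≡+∣∣² u) (square≡+∣∣² b) ⟩
    + ∣ u ∣² ℤ.+ + 3 ℤ.* + ∣ b ∣²        ≡⟨ cong (ℤ._+_ (+ ∣ u ∣²)) (ℤP.pos-* 3 ∣ b ∣²) ⟨
    + ∣ u ∣² ℤ.+ + (3 ℕ.* ∣ b ∣²)        ≡⟨ ℤP.pos-+ ∣ u ∣² _ ⟨
    + (∣ u ∣² ℕ.+ 3 ℕ.* ∣ b ∣²)          ∎)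
    where open ≡-Reasoning

∣i∣≤1⇒i∈[-1,1] : ∀ i → ∣ i ∣ ≤ 1 → i ≡ -[1+ 0 ] ⊎ i ≡ + 0 ⊎ i ≡ + 1
∣i∣≤1⇒i∈[-1,1] (+ 0)           _             = inj₂ (inj₁ refl)
∣i∣≤1⇒i∈[-1,1] (+ 1)           _             = inj₂ (inj₂ refl)
∣i∣≤1⇒i∈[-1,1] -[1+ 0 ]        _             = inj₁ refl
∣i∣≤1⇒i∈[-1,1] (+ suc (suc _)) (s≤s ())
∣i∣≤1⇒i∈[-1,1] -[1+ suc _ ]    (s≤s ())

-- A cube root of unity has norm 1, so both of its coordinates lie in {-1, 0, 1}.
cube≡1⇒cubeRoot : ∀ x → cube x ≡ 1E → CubeRootOfUnity x
cube≡1⇒cubeRoot x@(mkE a b) x³≡1 =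
  classify (∣i∣≤1⇒i∈[-1,1] a ∣a∣≤1) (∣i∣≤1⇒i∈[-1,1] b ∣b∣≤1) x³≡1
  where
  N≡1 : normE x ≡ + 1
  N≡1 = cube≡1⇒≡1 (normE x) (begin
    normE x ℤ.* (normE x ℤ.* normE x)  ≡⟨ cong (normE x ℤ.*_) (normE-* x x) ⟨
    normE x ℤ.* normE (x *E x)         ≡⟨ normE-* x (x *E x) ⟨
    normE (cube x)                     ≡⟨ cong normE x³≡1 ⟩
    + 1                                ∎)
    where open ≡-Reasoning
  ∣b∣≤1 : ∣ b ∣ ≤ 1
  ∣b∣≤1 = normE≡1⇒∣im∣≤1 a b N≡1
  ∣a∣≤1 : ∣ a ∣ ≤ 1
  ∣a∣≤1 = normE≡1⇒∣im∣≤1 b a (trans (sym (normE-swap a b)) N≡1)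
  classify : ∀ {a b} → a ≡ -[1+ 0 ] ⊎ a ≡ + 0 ⊎ a ≡ + 1 → b ≡ -[1+ 0 ] ⊎ b ≡ + 0 ⊎ b ≡ + 1 →
             cube (mkE a b) ≡ 1E → CubeRootOfUnity (mkE a b)
  classify (inj₁ refl)        (inj₁ refl)        _  = ω²-root
  classify (inj₂ (inj₁ refl)) (inj₂ (inj₂ refl)) _  = ω-root
  classify (inj₂ (inj₂ refl)) (inj₂ (inj₁ refl)) _  = 1-root
  classify (inj₁ refl)        (inj₂ (inj₁ refl)) ()
  classify (inj₁ refl)        (inj₂ (inj₂ refl)) ()
  classify (inj₂ (inj₁ refl)) (inj₁ refl)        ()
  classify (inj₂ (inj₁ refl)) (inj₂ (inj₁ refl)) ()
  classify (inj₂ (inj₂ refl)) (inj₁ refl)        ()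
  classify (inj₂ (inj₂ refl)) (inj₂ (inj₂ refl)) ()

normE-cubeRoot : ∀ {w} → CubeRootOfUnity w → normE w ≡ + 1
normE-cubeRoot 1-root  = refl
normE-cubeRoot ω-root  = refl
normE-cubeRoot ω²-root = refl

*E-zeroʳ : ∀ x → x *E 0E ≡ 0E
*E-zeroʳ (mkE a b) = cong₂ mkE (identity₁ a b) (identity₂ a b)
  where
  identity₁ : ∀ a b → a ℤ.* + 0 ℤ.- b ℤ.* + 0 ≡ + 0
  identity₁ = solve-∀
  identity₂ : ∀ a b → a ℤ.* + 0 ℤ.+ b ℤ.* + 0 ℤ.- b ℤ.* + 0 ≡ + 0
  identity₂ = solve-∀

cubeRoot-quotient : ∀ {c w} → CubeRootOfUnity c → CubeRootOfUnity w →
                    Σ E λ w′ → CubeRootOfUnity w′ × c *E w′ ≡ w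
cubeRoot-quotient 1-root  1-root  = 1E  , 1-root  , refl
cubeRoot-quotient 1-root  ω-root  = ωE  , ω-root  , refl
cubeRoot-quotient 1-root  ω²-root = ω²E , ω²-root , refl
cubeRoot-quotient ω-root  1-root  = ω²E , ω²-root , refl
cubeRoot-quotient ω-root  ω-root  = 1E  , 1-root  , refl
cubeRoot-quotient ω-root  ω²-root = ωE  , ω-root  , refl
cubeRoot-quotient ω²-root 1-root  = ωE  , ω-root  , refl
cubeRoot-quotient ω²-root ω-root  = ω²E , ω²-root , refl
cubeRoot-quotient ω²-root ω²-root = 1E  , 1-root  , refl

-- inner x w = 2 Re (x · w̄) for the embedding ω = (-1 + √-3)/2.
inner : E → E → ℤ
inner (mkE a b) (mkE c d) = + 2 ℤ.* (a ℤ.* c ℤ.+ b ℤ.* d) ℤ.- (a ℤ.* d ℤ.+ b ℤ.* c)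

inner-+ : ∀ x y w → inner (x +E y) w ≡ inner x w ℤ.+ inner y w
inner-+ (mkE a b) (mkE a′ b′) (mkE c d) = identity a b a′ b′ c d
  where
  identity : ∀ a b a′ b′ c d →
    + 2 ℤ.* ((a ℤ.+ a′) ℤ.* c ℤ.+ (b ℤ.+ b′) ℤ.* d) ℤ.- ((a ℤ.+ a′) ℤ.* d ℤ.+ (b ℤ.+ b′) ℤ.* c) ≡
    (+ 2 ℤ.* (a ℤ.* c ℤ.+ b ℤ.* d) ℤ.- (a ℤ.* d ℤ.+ b ℤ.* c)) ℤ.+
    (+ 2 ℤ.* (a′ ℤ.* c ℤ.+ b′ ℤ.* d) ℤ.- (a′ ℤ.* d ℤ.+ b′ ℤ.* c))
  identity = solve-∀

-- Lagrange's identity 4 |x|² |w|² = (2 Re x w̄)² + 3 (a d - b c)².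
inner²≤4*normE*normE : ∀ x w → inner x w ℤ.* inner x w ℤ.≤ + 4 ℤ.* (normE x ℤ.* normE w)
inner²≤4*normE*normE (mkE a b) (mkE c d) = begin
  i ℤ.* i                                 ≤⟨ ℤP.i≤i+j (i ℤ.* i) (+ (3 ℕ.* ∣ δ ∣²)) ⟩
  i ℤ.* i ℤ.+ + (3 ℕ.* ∣ δ ∣²)            ≡⟨ cong (ℤ._+_ (i ℤ.* i)) (ℤP.pos-* 3 ∣ δ ∣²) ⟩
  i ℤ.* i ℤ.+ + 3 ℤ.* + ∣ δ ∣²            ≡⟨ cong (λ e → i ℤ.* i ℤ.+ + 3 ℤ.* e) (square≡+∣∣² δ) ⟨
  i ℤ.* i ℤ.+ + 3 ℤ.* (δ ℤ.* δ)           ≡⟨ lagrange a b c d ⟨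
  + 4 ℤ.* (normE (mkE a b) ℤ.* normE (mkE c d)) ∎
  where
  open ℤP.≤-Reasoning
  i δ : ℤ
  i = inner (mkE a b) (mkE c d)
  δ = a ℤ.* d ℤ.- b ℤ.* c
  ∣_∣² : ℤ → ℕ
  ∣ j ∣² = ∣ j ∣ ℕ.* ∣ j ∣
  lagrange : ∀ a b c d →
    + 4 ℤ.* ((a ℤ.* a ℤ.- a ℤ.* b ℤ.+ b ℤ.* b) ℤ.* (c ℤ.* c ℤ.- c ℤ.* d ℤ.+ d ℤ.* d)) ≡
    (+ 2 ℤ.* (a ℤ.* c ℤ.+ b ℤ.* d) ℤ.- (a ℤ.* d ℤ.+ b ℤ.* c)) ℤ.*
    (+ 2 ℤ.* (a ℤ.* c ℤ.+ b ℤ.* d) ℤ.- (a ℤ.* d ℤ.+ b ℤ.* c))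
    ℤ.+ + 3 ℤ.* ((a ℤ.* d ℤ.- b ℤ.* c) ℤ.* (a ℤ.* d ℤ.- b ℤ.* c))
  lagrange = solve-∀

-- Counting

indicator : ∀ {p} {P : Set p} → Dec P → ℕ
indicator P? = if does P? then 1 else 0

count : ∀ {p} {P : Pred ℕ p} → Decidable P → ℕ → ℕ
count P? zero    = 0
count P? (suc n) = count P? n ℕ.+ indicator (P? n)

indicator-⊎ : ∀ {p q r} {P : Set p} {Q : Set q} {R : Set r} (P? : Dec P) (Q? : Dec Q) (R? : Dec R) →
              (P → Q ⊎ R) → indicator P? ≤ indicator Q? ℕ.+ indicator R?
indicator-⊎ (no _)  _        _        _     = z≤n
indicator-⊎ (yes _) (yes _)  _        _     = s≤s z≤n
indicator-⊎ (yes _) (no _)   (yes _)  _     = s≤s z≤n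
indicator-⊎ (yes p) (no ¬q)  (no ¬r)  split = ⊥-elim ([ ¬q , ¬r ] (split p))

module _ {p q r} {P : Pred ℕ p} {Q : Pred ℕ q} {R : Pred ℕ r} where

  count-⊎ : (P? : Decidable P) (Q? : Decidable Q) (R? : Decidable R) →
            ∀ h → (∀ {n} → n < h → P n → Q n ⊎ R n) → count P? h ≤ count Q? h ℕ.+ count R? h
  count-⊎ P? Q? R? zero    _     = z≤n
  count-⊎ P? Q? R? (suc h) split = ℕP.≤-trans
    (ℕP.+-mono-≤ (count-⊎ P? Q? R? h (λ n<h → split (ℕP.m<n⇒m<1+n n<h)))
                 (indicator-⊎ (P? h) (Q? h) (R? h) (split ℕP.≤-refl)))
    (ℕP.≤-reflexive (interchange (count Q? h) (count R? h) (indicator (Q? h)) (indicator (R? h))))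
    where
    interchange : ∀ a b c d → a ℕ.+ b ℕ.+ (c ℕ.+ d) ≡ a ℕ.+ c ℕ.+ (b ℕ.+ d)
    interchange = ℕ-Solver.solve-∀

count-none : ∀ {p} {P : Pred ℕ p} (P? : Decidable P) h → (∀ {n} → n < h → ¬ P n) → count P? h ≡ 0
count-none P? zero    _    = refl
count-none P? (suc h) none with P? h
... | yes Ph = contradiction Ph (none ℕP.≤-refl)
... | no  _  = trans (ℕP.+-identityʳ _) (count-none P? h (λ n<h → none (ℕP.m<n⇒m<1+n n<h)))

count-≤1 : ∀ {p} {P : Pred ℕ p} (P? : Decidable P) h →
           (∀ {m n} → m < h → n < h → P m → P n → m ≡ n) → count P? h ≤ 1
count-≤1 P? zero    _      = z≤n
count-≤1 P? (suc h) unique with P? h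
... | yes Ph = ℕP.≤-reflexive (cong (ℕ._+ 1) (count-none P? h λ n<h Pn →
                 ℕP.<-irrefl (unique (ℕP.m<n⇒m<1+n n<h) ℕP.≤-refl Pn Ph) n<h))
... | no  _  = ℕP.≤-trans (ℕP.≤-reflexive (ℕP.+-identityʳ _))
                 (count-≤1 P? h (λ m<h n<h → unique (ℕP.m<n⇒m<1+n m<h) (ℕP.m<n⇒m<1+n n<h)))

count-≤-length : ∀ {a p q} {A : Set a} {P : Pred ℕ p} {R : A → Pred ℕ q}
                 (P? : Decidable P) (R? : ∀ r → Decidable (R r)) h rs →
                 (∀ {n} → n < h → P n → Any (λ r → R r n) rs) →
                 All (λ r → ∀ {m n} → m < h → n < h → R r m → R r n → m ≡ n) rs →
                 count P? h ≤ length rs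
count-≤-length P? R? h [] marked [] =
  ℕP.≤-reflexive (count-none P? h (λ n<h Pn → ¬Any[] (marked n<h Pn)))
count-≤-length {P = P} {R} P? R? h (r ∷ rs) marked (unique ∷ uniques) = ℕP.≤-trans
  (count-⊎ P? (R? r) (P? ∩? ∁? (R? r)) h split)
  (ℕP.+-mono-≤ (count-≤1 (R? r) h unique) (count-≤-length (P? ∩? ∁? (R? r)) R? h rs marked′ uniques))
  where
  split : ∀ {n} → n < h → P n → R r n ⊎ (P ∩ ∁ (R r)) n
  split {n} _ Pn with R? r n
  ... | yes Rrn = inj₁ Rrn
  ... | no ¬Rrn = inj₂ (Pn , ¬Rrn)
  marked′ : ∀ {n} → n < h → (P ∩ ∁ (R r)) n → Any (λ r → R r n) rs
  marked′ n<h (Pn , ¬Rrn) with marked n<h Pn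
  ... | here Rrn = contradiction Rrn ¬Rrn
  ... | there m  = m

-- Sums of cube roots of unity

inner-cubeRoots : ∀ {v w} → CubeRootOfUnity v → CubeRootOfUnity w →
                  inner v w ℤ.+ + 1 ≡ + (3 ℕ.* indicator (v ≟E w))
inner-cubeRoots 1-root  1-root  = refl
inner-cubeRoots 1-root  ω-root  = refl
inner-cubeRoots 1-root  ω²-root = refl
inner-cubeRoots ω-root  1-root  = refl
inner-cubeRoots ω-root  ω-root  = refl
inner-cubeRoots ω-root  ω²-root = refl
inner-cubeRoots ω²-root 1-root  = refl
inner-cubeRoots ω²-root ω-root  = refl
inner-cubeRoots ω²-root ω²-root = refl

inner-charSum : ∀ χ z {w} h → (∀ {n} → n < h → CubeRootOfUnity (χ (z ℤ.+ + n))) → CubeRootOfUnity w →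
                inner (charSum χ z h) w ℤ.+ + h ≡ + (3 ℕ.* count (λ n → χ (z ℤ.+ + n) ≟E w) h)
inner-charSum χ z zero    _     1-root  = refl
inner-charSum χ z zero    _     ω-root  = refl
inner-charSum χ z zero    _     ω²-root = refl
inner-charSum χ z {w} (suc h) roots w-root = begin
  inner (S +E g) w ℤ.+ + suc h                      ≡⟨ cong (ℤ._+ + suc h) (inner-+ S g w) ⟩
  inner S w ℤ.+ inner g w ℤ.+ (+ 1 ℤ.+ + h)         ≡⟨ regroup (inner S w) (inner g w) (+ h) ⟩
  (inner S w ℤ.+ + h) ℤ.+ (inner g w ℤ.+ + 1)
    ≡⟨ cong₂ ℤ._+_ (inner-charSum χ z h (λ n<h → roots (ℕP.m<n⇒m<1+n n<h)) w-root)
                   (inner-cubeRoots (roots ℕP.≤-refl) w-root) ⟩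
  + (3 ℕ.* K) ℤ.+ + (3 ℕ.* I)                       ≡⟨ ℤP.pos-+ (3 ℕ.* K) (3 ℕ.* I) ⟨
  + (3 ℕ.* K ℕ.+ 3 ℕ.* I)                           ≡⟨ cong +_ (ℕP.*-distribˡ-+ 3 K I) ⟨
  + (3 ℕ.* (K ℕ.+ I))                               ∎
  where
  open ≡-Reasoning
  S g : E
  S = charSum χ z h
  g = χ (z ℤ.+ + h)
  K I : ℕ
  K = count (λ n → χ (z ℤ.+ + n) ≟E w) h
  I = indicator (g ≟E w)
  regroup : ∀ a b c → a ℤ.+ b ℤ.+ (+ 1 ℤ.+ c) ≡ (a ℤ.+ c) ℤ.+ (b ℤ.+ + 1)
  regroup = solve-∀

-- The value w occurs K times among the h summands, so 2 Re (S w̄) = 3K - h.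
charSum-bound : ∀ χ z {w ℓ} h → (∀ {n} → n < h → CubeRootOfUnity (χ (z ℤ.+ + n))) → CubeRootOfUnity w →
                count (λ n → χ (z ℤ.+ + n) ≟E w) h ≤ ℓ → 3 ℕ.* ℓ ≤ h →
                + ((h ∸ 3 ℕ.* ℓ) ℕ.* (h ∸ 3 ℕ.* ℓ)) ℤ.≤ + 4 ℤ.* normE (charSum χ z h)
charSum-bound χ z {w} {ℓ} h roots w-root K≤ℓ 3ℓ≤h = begin
  + ((h ∸ 3 ℕ.* ℓ) ℕ.* (h ∸ 3 ℕ.* ℓ))  ≤⟨ ℤ.+≤+ (ℕP.*-mono-≤ h∸3ℓ≤h∸3K h∸3ℓ≤h∸3K) ⟩
  + ((h ∸ 3 ℕ.* K) ℕ.* (h ∸ 3 ℕ.* K))  ≡⟨ cong (λ m → + (m ℕ.* m)) ∣i∣≡h∸3K ⟨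
  + (∣ i ∣ ℕ.* ∣ i ∣)                  ≡⟨ square≡+∣∣² i ⟨
  i ℤ.* i                              ≤⟨ inner²≤4*normE*normE S w ⟩
  + 4 ℤ.* (normE S ℤ.* normE w)        ≡⟨ cong (λ n → + 4 ℤ.* (normE S ℤ.* n)) (normE-cubeRoot w-root) ⟩
  + 4 ℤ.* (normE S ℤ.* + 1)            ≡⟨ cong (ℤ._*_ (+ 4)) (ℤP.*-identityʳ (normE S)) ⟩
  + 4 ℤ.* normE S                      ∎
  where
  open ℤP.≤-Reasoning
  S : E
  S = charSum χ z h
  i : ℤ
  i = inner S w
  K : ℕ
  K = count (λ n → χ (z ℤ.+ + n) ≟E w) h
  h∸3ℓ≤h∸3K : h ∸ 3 ℕ.* ℓ ≤ h ∸ 3 ℕ.* K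
  h∸3ℓ≤h∸3K = ℕP.∸-monoʳ-≤ h (ℕP.*-monoʳ-≤ 3 K≤ℓ)
  i≡3K⊖h : i ≡ 3 ℕ.* K ⊖ h
  i≡3K⊖h = trans (trans (cancel i (+ h)) (cong (ℤ._- + h) (inner-charSum χ z h roots w-root)))
                 (ℤP.m-n≡m⊖n (3 ℕ.* K) h)
    where
    cancel : ∀ a b → a ≡ a ℤ.+ b ℤ.- b
    cancel = solve-∀
  ∣i∣≡h∸3K : ∣ i ∣ ≡ h ∸ 3 ℕ.* K
  ∣i∣≡h∸3K = trans (cong ∣_∣ i≡3K⊖h) (ℤP.∣⊖∣-≤ (ℕP.≤-trans (ℕP.*-monoʳ-≤ 3 K≤ℓ) 3ℓ≤h))

-- Coprimality and arithmetic progressions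

coprime-* : ∀ {m a b} → Coprime m a → Coprime m b → Coprime m (a ℕ.* b)
coprime-* {m} {a} m⊥a m⊥b {d} (d∣m , d∣ab) = m⊥b (d∣m , coprime-divisor d⊥a d∣ab)
  where
  d⊥a : Coprime d a
  d⊥a (e∣d , e∣a) = m⊥a (∣-trans e∣d d∣m , e∣a)

coprime-product : ∀ {m ps} → All (Coprime m) ps → Coprime m (product ps)
coprime-product []            (_ , d∣1) = ∣1⇒≡1 d∣1
coprime-product (m⊥p ∷ m⊥ps)            = coprime-* m⊥p (coprime-product m⊥ps)

prime∤⇒coprime : ∀ {p m} → Prime p → ¬ p ∣ m → Coprime m p
prime∤⇒coprime p-prime p∤m (d∣m , d∣p) with prime⇒irreducible p-prime d∣p
... | inj₁ d≡1 = d≡1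
... | inj₂ refl = contradiction d∣m p∤m

non-coprime⇒prime-divisor : ∀ {m ps} → All Prime ps → ¬ Coprime m (product ps) → Any (_∣ m) ps
non-coprime⇒prime-divisor []                 m≁1  = ⊥-elim (m≁1 (coprime-product []))
non-coprime⇒prime-divisor {m} {p ∷ _} (p-prime ∷ primes) m≁∏ with p ∣? m
... | yes p∣m = here p∣m
... | no  p∤m = there (non-coprime⇒prime-divisor primes (m≁∏ ∘ coprime-* (prime∤⇒coprime p-prime p∤m)))

prime-common-divisor⇒¬coprime : ∀ {p a b} → Prime p → p ∣ a → p ∣ b → ¬ Coprime a b
prime-common-divisor⇒¬coprime p-prime p∣a p∣b a⊥b = ¬prime[1] (subst Prime (a⊥b (p∣a , p∣b)) p-prime)

∣∧<⇒≡0 : ∀ {r d} → r ∣ d → d < r → d ≡ 0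
∣∧<⇒≡0 {d = zero}  _   _   = refl
∣∧<⇒≡0 {d = suc _} r∣d d<r = contradiction r∣d (>⇒∤ d<r)

progression : ℤ → ℤ → ℤ → ℕ → ℤ
progression s z c n = s ℤ.* (z ℤ.+ + n) ℤ.+ c

i<j⇒0<j-i : ∀ {i j} → i ℤ.< j → + 0 ℤ.< j ℤ.- i
i<j⇒0<j-i {i} {j} i<j = subst (ℤ._< j ℤ.- i) (ℤP.+-inverseʳ i) (ℤP.+-monoˡ-< (ℤ.- i) i<j)

progression-mono : ∀ {s} z c {m n} → .{{ℤ.NonNegative s}} → m ≤ n →
                   progression s z c m ℤ.≤ progression s z c n
progression-mono {s} z c m≤n = ℤP.+-monoˡ-≤ c (ℤP.*-monoˡ-≤-nonNeg s (ℤP.+-monoʳ-≤ z (ℤ.+≤+ m≤n)))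

progression-antimono : ∀ {s} z c {m n} → .{{ℤ.NonPositive s}} → m ≤ n →
                       progression s z c n ℤ.≤ progression s z c m
progression-antimono {s} z c m≤n = ℤP.+-monoˡ-≤ c (ℤP.*-monoˡ-≤-nonPos s (ℤP.+-monoʳ-≤ z (ℤ.+≤+ m≤n)))

∣s∣∧∣progression⇒∣c : ∀ {r} s z c n → r ∣ ∣ s ∣ → r ∣ ∣ progression s z c n ∣ → r ∣ ∣ c ∣
∣s∣∧∣progression⇒∣c {r} s z c n r∣s r∣P = ℤ∣.∣⇒∣ᵤ {+ r} {c}
  (ℤ∣.∣m+n∣m⇒∣n (ℤ∣.∣ᵤ⇒∣ {+ r} {progression s z c n} r∣P)
                (ℤ∣.∣m⇒∣m*n (z ℤ.+ + n) (ℤ∣.∣ᵤ⇒∣ {+ r} {s} r∣s)))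

∣progression⇒∣s*difference : ∀ {r} s z c {a b} → a ≤ b →
                              r ∣ ∣ progression s z c a ∣ → r ∣ ∣ progression s z c b ∣ → r ∣ ∣ s ∣ ℕ.* (b ∸ a)
∣progression⇒∣s*difference {r} s z c {a} {b} a≤b r∣Pa r∣Pb =
  subst (r ∣_) (trans (cong ∣_∣ difference) (ℤP.abs-* s (+ (b ∸ a))))
    (ℤ∣.∣⇒∣ᵤ {+ r} (ℤ∣.∣m∣n⇒∣m-n (ℤ∣.∣ᵤ⇒∣ {+ r} {progression s z c b} r∣Pb)
                                 (ℤ∣.∣ᵤ⇒∣ {+ r} {progression s z c a} r∣Pa)))
  where
  identity : ∀ s z c a d → s ℤ.* (z ℤ.+ (a ℤ.+ d)) ℤ.+ c ℤ.- (s ℤ.* (z ℤ.+ a) ℤ.+ c) ≡ s ℤ.* d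
  identity = solve-∀
  difference : progression s z c b ℤ.- progression s z c a ≡ s ℤ.* + (b ∸ a)
  difference = begin
    progression s z c b ℤ.- progression s z c a
      ≡⟨ cong (λ e → s ℤ.* (z ℤ.+ + e) ℤ.+ c ℤ.- progression s z c a) (ℕP.m+[n∸m]≡n a≤b) ⟨
    s ℤ.* (z ℤ.+ + (a ℕ.+ (b ∸ a))) ℤ.+ c ℤ.- progression s z c a
      ≡⟨ cong (λ e → s ℤ.* (z ℤ.+ e) ℤ.+ c ℤ.- progression s z c a) (ℤP.pos-+ a (b ∸ a)) ⟩
    s ℤ.* (z ℤ.+ (+ a ℤ.+ + (b ∸ a))) ℤ.+ c ℤ.- progression s z c a
      ≡⟨ identity s z c (+ a) (+ (b ∸ a)) ⟩
    s ℤ.* + (b ∸ a) ∎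
    where open ≡-Reasoning

prime∣progression-ordered : ∀ {r} s z c {a b} → Prime r → ¬ r ∣ ∣ s ∣ → a ≤ b → b < r →
                            r ∣ ∣ progression s z c a ∣ → r ∣ ∣ progression s z c b ∣ → a ≡ b
prime∣progression-ordered {r} s z c {a} {b} r-prime r∤s a≤b b<r r∣Pa r∣Pb
  with euclidsLemma ∣ s ∣ (b ∸ a) r-prime (∣progression⇒∣s*difference s z c a≤b r∣Pa r∣Pb)
... | inj₁ r∣s   = contradiction r∣s r∤s
... | inj₂ r∣b-a = ℕP.≤-antisym a≤b (ℕP.m∸n≡0⇒m≤n (∣∧<⇒≡0 r∣b-a (ℕP.≤-<-trans (ℕP.m∸n≤m b a) b<r)))

prime∣progression-unique : ∀ {r} s z c {a b} → Prime r → ¬ r ∣ ∣ s ∣ → a < r → b < r →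
                           r ∣ ∣ progression s z c a ∣ → r ∣ ∣ progression s z c b ∣ → a ≡ b
prime∣progression-unique s z c {a} {b} r-prime r∤s a<r b<r r∣Pa r∣Pb with ℕP.≤-total a b
... | inj₁ a≤b = prime∣progression-ordered s z c r-prime r∤s a≤b b<r r∣Pa r∣Pb
... | inj₂ b≤a = sym (prime∣progression-ordered s z c r-prime r∤s b≤a a<r r∣Pb r∣Pa)

-- The intervals 𝓘 and 𝓙

ℤtoℚ≃mkℚᵘ : ∀ i → toℚᵘ (ℤtoℚ i) ℚᵘ.≃ mkℚᵘ i 0
ℤtoℚ≃mkℚᵘ i = ℚP.toℚᵘ-fromℚᵘ (mkℚᵘ i 0)

ℤtoℚ-+ : ∀ i j → ℤtoℚ (i ℤ.+ j) ≡ ℤtoℚ i ℚ.+ ℤtoℚ j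
ℤtoℚ-+ i j = ℚP.toℚᵘ-injective (begin
  toℚᵘ (ℤtoℚ (i ℤ.+ j))             ≈⟨ ℤtoℚ≃mkℚᵘ (i ℤ.+ j) ⟩
  mkℚᵘ (i ℤ.+ j) 0                  ≈⟨ *≡* (identity i j) ⟩
  mkℚᵘ i 0 ℚᵘ.+ mkℚᵘ j 0            ≈⟨ ℚᵘP.+-cong (ℤtoℚ≃mkℚᵘ i) (ℤtoℚ≃mkℚᵘ j) ⟨
  toℚᵘ (ℤtoℚ i) ℚᵘ.+ toℚᵘ (ℤtoℚ j)  ≈⟨ ℚP.toℚᵘ-homo-+ (ℤtoℚ i) (ℤtoℚ j) ⟨
  toℚᵘ (ℤtoℚ i ℚ.+ ℤtoℚ j)          ∎)
  where
  open ℚᵘP.≃-Reasoning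
  identity : ∀ i j → (i ℤ.+ j) ℤ.* + 1 ≡ (i ℤ.* + 1 ℤ.+ j ℤ.* + 1) ℤ.* + 1
  identity = solve-∀

ℤtoℚ-* : ∀ i j → ℤtoℚ (i ℤ.* j) ≡ ℤtoℚ i ℚ.* ℤtoℚ j
ℤtoℚ-* i j = ℚP.toℚᵘ-injective (begin
  toℚᵘ (ℤtoℚ (i ℤ.* j))             ≈⟨ ℤtoℚ≃mkℚᵘ (i ℤ.* j) ⟩
  mkℚᵘ i 0 ℚᵘ.* mkℚᵘ j 0            ≈⟨ ℚᵘP.*-cong (ℤtoℚ≃mkℚᵘ i) (ℤtoℚ≃mkℚᵘ j) ⟨
  toℚᵘ (ℤtoℚ i) ℚᵘ.* toℚᵘ (ℤtoℚ j)  ≈⟨ ℚP.toℚᵘ-homo-* (ℤtoℚ i) (ℤtoℚ j) ⟨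
  toℚᵘ (ℤtoℚ i ℚ.* ℤtoℚ j)          ∎)
  where open ℚᵘP.≃-Reasoning

ℤtoℚ-neg : ∀ i → ℤtoℚ (ℤ.- i) ≡ ℚ.- ℤtoℚ i
ℤtoℚ-neg i = ℚP.toℚᵘ-injective (begin
  toℚᵘ (ℤtoℚ (ℤ.- i))   ≈⟨ ℤtoℚ≃mkℚᵘ (ℤ.- i) ⟩
  ℚᵘ.- mkℚᵘ i 0         ≈⟨ ℚᵘP.-‿cong (ℤtoℚ≃mkℚᵘ i) ⟨
  ℚᵘ.- toℚᵘ (ℤtoℚ i)    ≈⟨ ℚP.toℚᵘ-homo‿- (ℤtoℚ i) ⟨
  toℚᵘ (ℚ.- ℤtoℚ i)     ∎)
  where open ℚᵘP.≃-Reasoning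

ℤtoℚ-- : ∀ i j → ℤtoℚ (i ℤ.- j) ≡ ℤtoℚ i ℚ.- ℤtoℚ j
ℤtoℚ-- i j = trans (ℤtoℚ-+ i (ℤ.- j)) (cong (ℚ._+_ (ℤtoℚ i)) (ℤtoℚ-neg j))

ℤtoℚ-mono-≤ : ∀ {i j} → i ℤ.≤ j → ℤtoℚ i ℚ.≤ ℤtoℚ j
ℤtoℚ-mono-≤ {i} {j} i≤j = ℚP.toℚᵘ-cancel-≤
  (ℚᵘP.≤-respʳ-≃ (ℚᵘP.≃-sym (ℤtoℚ≃mkℚᵘ j)) (ℚᵘP.≤-respˡ-≃ (ℚᵘP.≃-sym (ℤtoℚ≃mkℚᵘ i))
    (*≤* (subst₂ ℤ._≤_ (sym (ℤP.*-identityʳ i)) (sym (ℤP.*-identityʳ j)) i≤j))))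

ℤtoℚ-cancel-< : ∀ {i j} → ℤtoℚ i ℚ.< ℤtoℚ j → i ℤ.< j
ℤtoℚ-cancel-< {i} {j} i<j
  with ℚᵘP.<-respʳ-≃ (ℤtoℚ≃mkℚᵘ j) (ℚᵘP.<-respˡ-≃ (ℤtoℚ≃mkℚᵘ i) (ℚP.toℚᵘ-mono-< i<j))
... | *<* i*1<j*1 = subst₂ ℤ._<_ (ℤP.*-identityʳ i) (ℤP.*-identityʳ j) i*1<j*1

1/n*n≡1 : ∀ n .{{_ : NonZero n}} → (+ 1 ℚ./ n) ℚ.* ℕtoℚ n ≡ ℚ.1ℚ
1/n*n≡1 (suc n-1) = ℚP.toℚᵘ-injective (begin
  toℚᵘ ((+ 1 ℚ./ suc n-1) ℚ.* ℕtoℚ (suc n-1))          ≈⟨ ℚP.toℚᵘ-homo-* (+ 1 ℚ./ suc n-1) (ℕtoℚ (suc n-1)) ⟩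
  toℚᵘ (+ 1 ℚ./ suc n-1) ℚᵘ.* toℚᵘ (ℕtoℚ (suc n-1))   ≈⟨ ℚᵘP.*-cong (ℚP.toℚᵘ-fromℚᵘ (mkℚᵘ (+ 1) n-1))
                                                                     (ℤtoℚ≃mkℚᵘ (+ suc n-1)) ⟩
  mkℚᵘ (+ 1) n-1 ℚᵘ.* mkℚᵘ (+ suc n-1) 0               ≈⟨ *≡* (identity (+ suc n-1)) ⟩
  ℚᵘ.1ℚᵘ                                               ∎)
  where
  open ℚᵘP.≃-Reasoning
  identity : ∀ n → (+ 1 ℤ.* n) ℤ.* + 1 ≡ + 1 ℤ.* (n ℤ.* + 1)
  identity = solve-∀

module _ (q : ℕ) .{{_ : NonZero q}} where

  ℕtoℚ-pos : ℚ.Positive (ℕtoℚ q)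
  ℕtoℚ-pos = ℚP.normalize-pos q 1

  ÷ℕ-*-cancel : ∀ x → (x ÷ℕ q) ℚ.* ℕtoℚ q ≡ x
  ÷ℕ-*-cancel x = begin
    (x ℚ.* (+ 1 ℚ./ q)) ℚ.* ℕtoℚ q   ≡⟨ ℚP.*-assoc x _ _ ⟩
    x ℚ.* ((+ 1 ℚ./ q) ℚ.* ℕtoℚ q)   ≡⟨ cong (ℚ._*_ x) (1/n*n≡1 q) ⟩
    x ℚ.* ℚ.1ℚ                        ≡⟨ ℚP.*-identityʳ x ⟩
    x                                 ∎
    where open ≡-Reasoning

  private
    Q≥0 : ℚ.NonNegative (ℕtoℚ q)
    Q≥0 = ℚP.pos⇒nonNeg (ℕtoℚ q) {{ℕtoℚ-pos}}

  ÷ℕ<⇒<* : ∀ {x y} → x ÷ℕ q ℚ.< y → x ℚ.< y ℚ.* ℕtoℚ q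
  ÷ℕ<⇒<* {x} {y} lt = subst (ℚ._< _) (÷ℕ-*-cancel x) (ℚP.*-monoˡ-<-pos (ℕtoℚ q) {{ℕtoℚ-pos}} {x ÷ℕ q} {y} lt)

  <÷ℕ⇒*< : ∀ {x y} → y ℚ.< x ÷ℕ q → y ℚ.* ℕtoℚ q ℚ.< x
  <÷ℕ⇒*< {x} {y} lt = subst (_ ℚ.<_) (÷ℕ-*-cancel x) (ℚP.*-monoˡ-<-pos (ℕtoℚ q) {{ℕtoℚ-pos}} {y} {x ÷ℕ q} lt)

  ÷ℕ≤⇒≤* : ∀ {x y} → x ÷ℕ q ℚ.≤ y → x ℚ.≤ y ℚ.* ℕtoℚ q
  ÷ℕ≤⇒≤* {x} {y} le = subst (ℚ._≤ _) (÷ℕ-*-cancel x) (ℚP.*-monoʳ-≤-nonNeg (ℕtoℚ q) {{Q≥0}} {x ÷ℕ q} {y} le)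

  ≤÷ℕ⇒*≤ : ∀ {x y} → y ℚ.≤ x ÷ℕ q → y ℚ.* ℕtoℚ q ℚ.≤ x
  ≤÷ℕ⇒*≤ {x} {y} le = subst (_ ℚ.≤_) (÷ℕ-*-cancel x) (ℚP.*-monoʳ-≤-nonNeg (ℕtoℚ q) {{Q≥0}} {y} {x ÷ℕ q} le)

private
  module QS = +-*-Solver

  y-[1+k]+1+k≡y : ∀ y k → y ℚ.- ℕtoℚ (suc k) ℚ.+ ℕtoℚ 1 ℚ.+ ℕtoℚ k ≡ y
  y-[1+k]+1+k≡y y k = trans (cong (λ e → y ℚ.- e ℚ.+ ℕtoℚ 1 ℚ.+ ℕtoℚ k) 1+k≡1+k)
                            (cancel y (ℕtoℚ 1) (ℕtoℚ k))
    where
    1+k≡1+k : ℕtoℚ (suc k) ≡ ℕtoℚ 1 ℚ.+ ℕtoℚ k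
    1+k≡1+k = ℤtoℚ-+ (+ 1) (+ k)
    cancel : ∀ y o k → y ℚ.- (o ℚ.+ k) ℚ.+ o ℚ.+ k ≡ y
    cancel = QS.solve 3 (λ y o k → y QS.:- (o QS.:+ k) QS.:+ o QS.:+ k QS.:= y) refl

x≤y-[1+k]+1⇒x+k≤y : ∀ {x y} k → x ℚ.≤ y ℚ.- ℕtoℚ (suc k) ℚ.+ ℕtoℚ 1 → x ℚ.+ ℕtoℚ k ℚ.≤ y
x≤y-[1+k]+1⇒x+k≤y {x} {y} k le = subst (x ℚ.+ ℕtoℚ k ℚ.≤_) (y-[1+k]+1+k≡y y k) (ℚP.+-monoˡ-≤ (ℕtoℚ k) le)

x<y-[1+k]+1⇒x+k<y : ∀ {x y} k → x ℚ.< y ℚ.- ℕtoℚ (suc k) ℚ.+ ℕtoℚ 1 → x ℚ.+ ℕtoℚ k ℚ.< y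
x<y-[1+k]+1⇒x+k<y {x} {y} k lt = subst (x ℚ.+ ℕtoℚ k ℚ.<_) (y-[1+k]+1+k≡y y k) (ℚP.+-monoˡ-< (ℕtoℚ k) lt)

x≤a+b⇒x-a≤b : ∀ {x a b} → x ℚ.≤ a ℚ.+ b → x ℚ.- a ℚ.≤ b
x≤a+b⇒x-a≤b {x} {a} {b} le = subst (x ℚ.- a ℚ.≤_) (cancel a b) (ℚP.+-monoˡ-≤ (ℚ.- a) le)
  where
  cancel : ∀ a b → a ℚ.+ b ℚ.- a ≡ b
  cancel = QS.solve 2 (λ a b → a QS.:+ b QS.:- a QS.:= b) refl

a-b≤x⇒a-x≤b : ∀ {x a b} → a ℚ.- b ℚ.≤ x → a ℚ.- x ℚ.≤ b
a-b≤x⇒a-x≤b {x} {a} {b} le =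
  subst₂ ℚ._≤_ (cancelˡ a b x) (cancelʳ b x) (ℚP.+-monoˡ-≤ (b ℚ.- x) le)
  where
  cancelˡ : ∀ a b x → a ℚ.- b ℚ.+ (b ℚ.- x) ≡ a ℚ.- x
  cancelˡ = QS.solve 3 (λ a b x → a QS.:- b QS.:+ (b QS.:- x) QS.:= a QS.:- x) refl
  cancelʳ : ∀ b x → x ℚ.+ (b ℚ.- x) ≡ b
  cancelʳ = QS.solve 2 (λ b x → x QS.:+ (b QS.:- x) QS.:= b) refl

InRange : ℚ → ℤ → Set
InRange H i = + 0 ℤ.< i × ℤtoℚ i ℚ.≤ H

between⇒InRange : ∀ {H a b i} → + 0 ℤ.< a → ℤtoℚ b ℚ.≤ H → a ℤ.≤ i → i ℤ.≤ b → InRange H i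
between⇒InRange 0<a b≤H a≤i i≤b = ℤP.<-≤-trans 0<a a≤i , ℚP.≤-trans (ℤtoℚ-mono-≤ i≤b) b≤H

module _ (f h′ q t : ℕ) .{{_ : NonZero q}} (H : ℚ) (z : ℤ) where

  private
    T Z Q : ℚ
    T = ℕtoℚ (t ℕ.* f)
    Z = ℤtoℚ z
    Q = ℕtoℚ q

  inI⇒endpoints : inI f (suc h′) q t H z →
                  + 0 ℤ.< progression (+ q) z (ℤ.- + (t ℕ.* f)) 0 ×
                  ℤtoℚ (progression (+ q) z (ℤ.- + (t ℕ.* f)) h′) ℚ.≤ H
  inI⇒endpoints (lower , upper) =
    subst (λ e → + 0 ℤ.< e ℤ.- + (t ℕ.* f)) (commute z (+ q)) (i<j⇒0<j-i tf<zq) ,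
    subst (ℚ._≤ H) (sym value) (x≤a+b⇒x-a≤b (≤÷ℕ⇒*≤ q (x≤y-[1+k]+1⇒x+k≤y h′ upper)))
    where
    commute : ∀ z q → z ℤ.* q ≡ q ℤ.* (z ℤ.+ + 0)
    commute = solve-∀
    tf<zq : + (t ℕ.* f) ℤ.< z ℤ.* + q
    tf<zq = ℤtoℚ-cancel-< (subst (T ℚ.<_) (sym (ℤtoℚ-* z (+ q))) (÷ℕ<⇒<* q lower))
    value : ℤtoℚ (progression (+ q) z (ℤ.- + (t ℕ.* f)) h′) ≡ (Z ℚ.+ ℕtoℚ h′) ℚ.* Q ℚ.- T
    value = trans (ℤtoℚ-- (+ q ℤ.* (z ℤ.+ + h′)) (+ (t ℕ.* f)))
                  (cong (ℚ._- T) (trans (ℤtoℚ-* (+ q) (z ℤ.+ + h′))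
                                 (trans (ℚP.*-comm Q _) (cong (ℚ._* Q) (ℤtoℚ-+ z (+ h′))))))

  inJ⇒endpoints : inJ f (suc h′) q t H z →
                  + 0 ℤ.< progression (ℤ.- + q) z (+ (t ℕ.* f)) h′ ×
                  ℤtoℚ (progression (ℤ.- + q) z (+ (t ℕ.* f)) 0) ℚ.≤ H
  inJ⇒endpoints (lower , upper) =
    subst (+ 0 ℤ.<_) (reflect₁ (+ (t ℕ.* f)) (z ℤ.+ + h′) (+ q)) (i<j⇒0<j-i [z+h′]q<tf) ,
    subst (ℚ._≤ H) (sym value) (a-b≤x⇒a-x≤b {Z ℚ.* Q} {T} {H} (÷ℕ≤⇒≤* q lower))
    where
    reflect₁ : ∀ a x q → a ℤ.- x ℤ.* q ≡ (ℤ.- q) ℤ.* x ℤ.+ a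
    reflect₁ = solve-∀
    reflect₀ : ∀ a z q → (ℤ.- q) ℤ.* (z ℤ.+ + 0) ℤ.+ a ≡ a ℤ.- z ℤ.* q
    reflect₀ = solve-∀
    [z+h′]q<tf : (z ℤ.+ + h′) ℤ.* + q ℤ.< + (t ℕ.* f)
    [z+h′]q<tf = ℤtoℚ-cancel-< (subst (ℚ._< T)
      (sym (trans (ℤtoℚ-* (z ℤ.+ + h′) (+ q)) (cong (ℚ._* Q) (ℤtoℚ-+ z (+ h′)))))
      (<÷ℕ⇒*< q (x<y-[1+k]+1⇒x+k<y h′ upper)))
    value : ℤtoℚ (progression (ℤ.- + q) z (+ (t ℕ.* f)) 0) ≡ T ℚ.- Z ℚ.* Q
    value = trans (cong ℤtoℚ (reflect₀ (+ (t ℕ.* f)) z (+ q)))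
                  (trans (ℤtoℚ-- (+ (t ℕ.* f)) (z ℤ.* + q)) (cong (ℚ._-_ T) (ℤtoℚ-* z (+ q))))

interval⇒progression : ∀ f h′ q t .{{_ : NonZero q}} H z →
  inI f (suc h′) q t H z ⊎ inJ f (suc h′) q t H z →
  Σ ℤ λ s → Σ ℤ λ c → ∣ s ∣ ≡ q × ∣ c ∣ ≡ t ℕ.* f × (∀ {n} → n ≤ h′ → InRange H (progression s z c n))
interval⇒progression f h′ q t H z (inj₁ z∈I) =
  + q , c , refl , ℤP.∣-i∣≡∣i∣ (+ (t ℕ.* f)) , λ {n} n≤h′ →
    between⇒InRange {H} {P 0} {P h′} {P n} (proj₁ ends) (proj₂ ends)
      (progression-mono {+ q} z c z≤n) (progression-mono {+ q} z c n≤h′)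
  where
  c : ℤ
  c = ℤ.- + (t ℕ.* f)
  P : ℕ → ℤ
  P = progression (+ q) z c
  ends : + 0 ℤ.< P 0 × ℤtoℚ (P h′) ℚ.≤ H
  ends = inI⇒endpoints f h′ q t H z z∈I
interval⇒progression f h′ q t H z (inj₂ z∈J) =
  ℤ.- + q , c , ℤP.∣-i∣≡∣i∣ (+ q) , refl , λ {n} n≤h′ →
    between⇒InRange {H} {P h′} {P 0} {P n} (proj₁ ends) (proj₂ ends)
      (progression-antimono {ℤ.- + q} z c n≤h′) (progression-antimono {ℤ.- + q} z c z≤n)
  where
  c : ℤ
  c = + (t ℕ.* f)
  P : ℕ → ℤ
  P = progression (ℤ.- + q) z c
  ends : + 0 ℤ.< P h′ × ℤtoℚ (P 0) ℚ.≤ H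
  ends = inJ⇒endpoints f h′ q t H z z∈J
  instance
    -q≤0 : ℤ.NonPositive (ℤ.- + q)
    -q≤0 = ℤ.nonPositive (ℤP.neg-mono-≤ (ℤ.+≤+ z≤n))

-- The character on the progression

module _ {f} {χ : ℤ → E} (χ-char : IsDirichletCharE f χ) where

  open IsDirichletCharE χ-char

  periodic-* : ∀ k x → χ (x ℤ.+ + (k ℕ.* f)) ≡ χ x
  periodic-* zero    x = cong χ (ℤP.+-identityʳ x)
  periodic-* (suc k) x = begin
    χ (x ℤ.+ + (f ℕ.+ k ℕ.* f))        ≡⟨ cong (λ e → χ (x ℤ.+ e)) (ℤP.pos-+ f (k ℕ.* f)) ⟩
    χ (x ℤ.+ (+ f ℤ.+ + (k ℕ.* f)))    ≡⟨ cong χ (regroup x (+ f) (+ (k ℕ.* f))) ⟩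
    χ (x ℤ.+ + (k ℕ.* f) ℤ.+ + f)      ≡⟨ periodic _ ⟩
    χ (x ℤ.+ + (k ℕ.* f))              ≡⟨ periodic-* k x ⟩
    χ x                                ∎
    where
    open ≡-Reasoning
    regroup : ∀ x a b → x ℤ.+ (a ℤ.+ b) ≡ x ℤ.+ b ℤ.+ a
    regroup = solve-∀

  periodic-∣ : ∀ x c → f ∣ ∣ c ∣ → χ (x ℤ.+ c) ≡ χ x
  periodic-∣ x (+ _)    (divides k refl)   = periodic-* k x
  periodic-∣ x -[1+ m ] (divides k 1+m≡kf) = begin
    χ (x ℤ.+ -[1+ m ])                    ≡⟨ periodic-* k _ ⟨
    χ (x ℤ.+ -[1+ m ] ℤ.+ + (k ℕ.* f))    ≡⟨ cong (λ e → χ (x ℤ.+ -[1+ m ] ℤ.+ + e)) 1+m≡kf ⟨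
    χ (x ℤ.+ -[1+ m ] ℤ.+ + suc m)        ≡⟨ cong χ (cancel x (+ suc m)) ⟩
    χ x                                   ∎
    where
    open ≡-Reasoning
    cancel : ∀ x y → x ℤ.- y ℤ.+ y ≡ x
    cancel = solve-∀

  χ-progression : ∀ s z c n → f ∣ ∣ c ∣ → χ (progression s z c n) ≡ χ s *E χ (z ℤ.+ + n)
  χ-progression s z c n f∣c = trans (periodic-∣ (s ℤ.* (z ℤ.+ + n)) c f∣c) (multiplicative s (z ℤ.+ + n))

module _ {f} {χ : ℤ → E} (χ-cubic : IsCubicChar f χ) where

  open IsCubicChar χ-cubic
  open IsDirichletCharE isChar

  χ≢0⇒coprime : ∀ n → χ n ≢ 0E → Coprime ∣ n ∣ f
  χ≢0⇒coprime n χn≢0 with coprime? ∣ n ∣ f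
  ... | yes n⊥f = n⊥f
  ... | no  n≁f = contradiction (zero-nc n n≁f) χn≢0

  χ≢0⇒cubeRoot : ∀ n → χ n ≢ 0E → CubeRootOfUnity (χ n)
  χ≢0⇒cubeRoot n χn≢0 = cube≡1⇒cubeRoot (χ n) (cube-triv n (χ≢0⇒coprime n χn≢0))

module Sieve {f} (f-prime : Prime f) {χ : ℤ → E} (χ-cubic : IsCubicChar f χ)
             {q t : ℕ} (q⊥t : Coprime q t) (s z c : ℤ) (∣s∣≡q : ∣ s ∣ ≡ q) (∣c∣≡tf : ∣ c ∣ ≡ t ℕ.* f)
             {H : ℚ} (H<f : H ℚ.< ℕtoℚ f) {h′ : ℕ}
             (N-range : ∀ {n} → n ≤ h′ → InRange H (progression s z c n)) where

  open IsCubicChar χ-cubic using (isChar)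
  open IsDirichletCharE isChar using (nonzero-c)

  N : ℕ → ℤ
  N = progression s z c

  +∣N∣≡N : ∀ {n} → n ≤ h′ → + ∣ N n ∣ ≡ N n
  +∣N∣≡N n≤h′ = ℤP.0≤i⇒+∣i∣≡i (ℤP.<⇒≤ (proj₁ (N-range n≤h′)))

  ∣N∣≤H : ∀ {n} → n ≤ h′ → ℕtoℚ ∣ N n ∣ ℚ.≤ H
  ∣N∣≤H n≤h′ = subst (λ e → ℤtoℚ e ℚ.≤ H) (sym (+∣N∣≡N n≤h′)) (proj₂ (N-range n≤h′))

  0<∣N∣ : ∀ {n} → n ≤ h′ → 0 < ∣ N n ∣
  0<∣N∣ n≤h′ = ℤP.drop‿+<+ (subst (+ 0 ℤ.<_) (sym (+∣N∣≡N n≤h′)) (proj₁ (N-range n≤h′)))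

  ∣N∣⊥f : ∀ {n} → n ≤ h′ → Coprime ∣ N n ∣ f
  ∣N∣⊥f n≤h′ = Coprimality.sym (prime⇒coprime f-prime {{ℕ.>-nonZero (0<∣N∣ n≤h′)}}
                 (ℤP.drop‿+<+ (ℤtoℚ-cancel-< (ℚP.≤-<-trans (∣N∣≤H n≤h′) H<f))))

  χN≡χs*χ : ∀ n → χ (N n) ≡ χ s *E χ (z ℤ.+ + n)
  χN≡χs*χ n = χ-progression isChar s z c n (subst (f ∣_) (sym ∣c∣≡tf) (n∣m*n t))

  χN≢0 : ∀ {n} → n ≤ h′ → χ (N n) ≢ 0E
  χN≢0 {n} n≤h′ = nonzero-c (N n) (∣N∣⊥f n≤h′)

  χs≢0 : χ s ≢ 0E
  χs≢0 χs≡0 = χN≢0 z≤n (trans (χN≡χs*χ 0) (cong (_*E χ (z ℤ.+ + 0)) χs≡0))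

  q⊥tf : Coprime q (t ℕ.* f)
  q⊥tf = coprime-* q⊥t (subst (λ e → Coprime e f) ∣s∣≡q (χ≢0⇒coprime χ-cubic s χs≢0))

  prime∣q⇒∤N : ∀ {r} n → Prime r → r ∣ q → ¬ r ∣ ∣ N n ∣
  prime∣q⇒∤N {r} n r-prime r∣q r∣N = prime-common-divisor⇒¬coprime r-prime r∣q
    (subst (r ∣_) ∣c∣≡tf (∣s∣∧∣progression⇒∣c s z c n (subst (r ∣_) (sym ∣s∣≡q) r∣q) r∣N)) q⊥tf

  values-cubeRoots : ∀ {n} → n < suc h′ → CubeRootOfUnity (χ (z ℤ.+ + n))
  values-cubeRoots {n} n<h = χ≢0⇒cubeRoot χ-cubic (z ℤ.+ + n) λ χ≡0 →
    χN≢0 (ℕP.≤-pred n<h) (trans (χN≡χs*χ n) (trans (cong (χ s *E_) χ≡0) (*E-zeroʳ (χ s))))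

  module Occurrences {us vs : List ℕ} {w : E}
             (us-primes : All Prime us) (∏us∣q : product us ∣ q)
             (vs-large : All (λ p → Prime p × suc h′ ≤ p) vs)
             (w-root : CubeRootOfUnity w)
             (χ≢w : ∀ m → 1 ≤ m → ℕtoℚ m ℚ.≤ H → Coprime m (product us ℕ.* product vs) → χ (+ m) ≢ w) where

    private
      quotient : Σ E λ w′ → CubeRootOfUnity w′ × χ s *E w′ ≡ w
      quotient = cubeRoot-quotient (χ≢0⇒cubeRoot χ-cubic s χs≢0) w-root

    w′ : E
    w′ = proj₁ quotient

    w′-root : CubeRootOfUnity w′
    w′-root = proj₁ (proj₂ quotient)

    occurrence⇒prime-divisor : ∀ {n} → n < suc h′ → χ (z ℤ.+ + n) ≡ w′ → Any (λ r → r ∣ ∣ N n ∣) vs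
    occurrence⇒prime-divisor {n} n<h χ≡w′ = non-coprime⇒prime-divisor (All.map proj₁ vs-large)
      λ N⊥∏vs → χ≢w ∣ N n ∣ (0<∣N∣ n≤h′) (∣N∣≤H n≤h′) (coprime-* N⊥∏us N⊥∏vs) χN≡w
      where
      n≤h′ : n ≤ h′
      n≤h′ = ℕP.≤-pred n<h
      N⊥∏us : Coprime ∣ N n ∣ (product us)
      N⊥∏us = coprime-product (All.tabulate λ r∈us → let r-prime = All.lookup us-primes r∈us in
        prime∤⇒coprime r-prime (prime∣q⇒∤N n r-prime (∣-trans (∈⇒∣product r∈us) ∏us∣q)))
      χN≡w : χ (+ ∣ N n ∣) ≡ w
      χN≡w = begin
        χ (+ ∣ N n ∣)          ≡⟨ cong χ (+∣N∣≡N n≤h′) ⟩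
        χ (N n)                ≡⟨ χN≡χs*χ n ⟩
        χ s *E χ (z ℤ.+ + n)   ≡⟨ cong (χ s *E_) χ≡w′ ⟩
        χ s *E w′              ≡⟨ proj₂ (proj₂ quotient) ⟩
        w                      ∎
        where open ≡-Reasoning

    prime-divisor-unique : All (λ r → ∀ {a b} → a < suc h′ → b < suc h′ → r ∣ ∣ N a ∣ → r ∣ ∣ N b ∣ → a ≡ b) vs
    prime-divisor-unique = All.map unique vs-large
      where
      unique : ∀ {r} → Prime r × suc h′ ≤ r →
               ∀ {a b} → a < suc h′ → b < suc h′ → r ∣ ∣ N a ∣ → r ∣ ∣ N b ∣ → a ≡ b
      unique {r} (r-prime , h≤r) {a} a<h b<h r∣Na r∣Nb =
        prime∣progression-unique s z c r-prime (λ r∣s → prime∣q⇒∤N a r-prime (subst (r ∣_) ∣s∣≡q r∣s) r∣Na)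
          (ℕP.<-≤-trans a<h h≤r) (ℕP.<-≤-trans b<h h≤r) r∣Na r∣Nb

    occurrences-≤-length : count (λ n → χ (z ℤ.+ + n) ≟E w′) (suc h′) ≤ length vs
    occurrences-≤-length = count-≤-length (λ n → χ (z ℤ.+ + n) ≟E w′) (λ r n → r ∣? ∣ N n ∣) (suc h′) vs
                                          occurrence⇒prime-divisor prime-divisor-unique

lemma9 : (f : ℕ) → Prime f → (χ : ℤ → E) → IsCubicChar f χ →
         (h : ℕ) → (us : List ℕ) → Unique us → All (λ p → Prime p × p < h) us →
         (vs : List ℕ) → Unique vs → All (λ p → Prime p × h ≤ p × p < f) vs →
         (H : ℚ) → ℚ.0ℚ ℚ.< H → H ℚ.< ℕtoℚ f →
         3 ℕ.* length vs ≤ h →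
         (q t : ℕ) → .{{_ : NonZero q}} → Coprime q t → t < q →
         ℕtoℚ (q ℕ.* h) ℚ.≤ H →
         (w : E) → cube w ≡ 1E →
         ((N : ℕ) → 1 ≤ N → ℕtoℚ N ℚ.≤ H → Coprime N (product us ℕ.* product vs) →
            χ (+ N) ≢ w) →
         product us ∣ q →
         (z : ℤ) → inI f h q t H z ⊎ inJ f h q t H z →
         (+ ((h ℕ.∸ 3 ℕ.* length vs) ℕ.* (h ℕ.∸ 3 ℕ.* length vs)))
           ℤ.≤ (+ 4) ℤ.* normE (charSum χ z h)
lemma9 f _ χ _ zero _ _ _ vs _ _ _ _ _ 3ℓ≤h _ _ _ _ _ _ _ _ _ z _ =
  charSum-bound χ z {ℓ = length vs} 0 (λ ()) 1-root z≤n 3ℓ≤h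
lemma9 f f-prime χ χ-cubic (suc h′) us _ us-small vs _ vs-large H _ H<f 3ℓ≤h q t q⊥t _ _ w w³≡1 χ≢w ∏us∣q z z∈I⊎J
  with interval⇒progression f h′ q t H z z∈I⊎J
... | s , c , ∣s∣≡q , ∣c∣≡tf , N-range =
  charSum-bound χ z (suc h′) values-cubeRoots w′-root occurrences-≤-length 3ℓ≤h
  where
  open Sieve f-prime χ-cubic q⊥t s z c ∣s∣≡q ∣c∣≡tf H<f N-range
  open Occurrences (All.map proj₁ us-small) ∏us∣q (All.map (λ (p-prime , h≤p , _) → p-prime , h≤p) vs-large)
           (cube≡1⇒cubeRoot w w³≡1) χ≢w
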